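{- For every integer $m\ge1$, every term $w_1\otimes\cdots\otimes w_{m+1}$ of $X\cdot P^m\cdot X\in B^{\otimes(m+1)}$ has $w_{m+1}\in\{X,Z\}$.
   Context: Let $\mathcal M=\mathbb Z\langle y,n\rangle/(yn=ny=n,\ n^2=0,\ y^2=y)$. In the ring $\mathcal M\otimes\mathcal M$ (tensor over $\mathbb Z$, with $(a\otimes b)(c\otimes d)=ac\otimes bd$) put $X=y\otimes n+n\otimes y$, $Y=y\otimes y$, $Z=n\otimes n$, and let $B$ be the $\mathbb Z$-span of $X,Y,Z$: a commutative subring, free abelian with basis $X,Y,Z$, with $X^2=2Z$, $Y^2=Y$, $Z^2=0$, $XY=YX=X$, $XZ=ZX=0$, $YZ=ZY=Z$. For $r\ge1$, $B^{\otimes r}$ is free abelian with basis the words $w_1\otimes\cdots\otimes w_r$, $w_i\in\{X,Y,Z\}$; writing $u\in B^{\otimes r}$ uniquely as $\sum_w c_w w$, a term of $u$ is a word $w$ with $c_w\ne0$, and $c_w$ is its coefficient. The chaining product $B^{\otimes r}\times B^{\otimes s}\to B^{\otimes(r+s-1)}$ is the bilinear (associative) map $(a_1\otimes\cdots\otimes a_r)\cdot(b_1\otimes\cdots\otimes b_s)=a_1\otimes\cdots\otimes a_{r-1}\otimes(a_rb_1)\otimes b_2\otimes\cdots\otimes b_s$. Elements of $B$ are regarded as elements of $B^{\otimes1}$. Let $P=X\otimes Y+Y\otimes X\in B^{\otimes2}$ and let $P^m\in B^{\otimes(m+1)}$ be its $m$-fold chaining product. -}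

module Defs where

open import Data.Nat using (ℕ; zero; suc; _+_)
open import Data.Integer using (ℤ; +_; _*_) renaming (_+_ to _+ℤ_)
open import Data.List using (List; []; _∷_; map; concatMap; filter; foldr)
open import Data.Vec using (Vec; []; _∷_)
open import Data.Vec.Properties using (≡-dec)
open import Data.Product using (_×_; _,_; proj₁; proj₂)
open import Relation.Binary.PropositionalEquality using (_≡_; refl)
open import Relation.Nullary using (Dec; yes; no)
open import Relation.Binary.Definitions using (DecidableEquality)

data Gen : Set where
  X Y Z : Gen

_≟G_ : DecidableEquality Gen
X ≟G X = yes refl
X ≟G Y = no λ ()
X ≟G Z = no λ ()
Y ≟G X = no λ ()
Y ≟G Y = yes refl
Y ≟G Z = no λ ()
Z ≟G X = no λ ()
Z ≟G Y = no λ ()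
Z ≟G Z = yes refl

genMul : Gen → Gen → List (ℤ × Gen)
genMul X X = (+ 2 , Z) ∷ []
genMul X Y = (+ 1 , X) ∷ []
genMul X Z = []
genMul Y X = (+ 1 , X) ∷ []
genMul Y Y = (+ 1 , Y) ∷ []
genMul Y Z = (+ 1 , Z) ∷ []
genMul Z X = []
genMul Z Y = (+ 1 , Z) ∷ []
genMul Z Z = []

-- An element of B^{⊗(n+1)}, represented by a formal (not necessarily reduced)
-- ℤ-linear combination of words w₁ ⊗ ⋯ ⊗ w_{n+1}.  Its actual value is given by
-- 'coeff' below (collecting coefficients of equal words).
Tensor : ℕ → Set
Tensor n = List (ℤ × Vec Gen (suc n))

coeff : {n : ℕ} → Tensor n → Vec Gen (suc n) → ℤ
coeff u w = foldr (λ p acc → proj₁ p +ℤ acc) (+ 0)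
                  (filter (λ p → ≡-dec _≟G_ (proj₂ p) w) u)

-- Chaining product of two words: a₁⊗⋯⊗a_{r}⊗(a_{r+1} b₁)⊗b₂⊗⋯⊗b_{s+1}.
chainW : {r s : ℕ} → Vec Gen (suc r) → Vec Gen (suc s) → List (ℤ × Vec Gen (suc (r + s)))
chainW {zero} (a ∷ []) (b ∷ bs) = map (λ p → proj₁ p , (proj₂ p ∷ bs)) (genMul a b)
chainW {suc r} (a ∷ as) bs = map (λ p → proj₁ p , (a ∷ proj₂ p)) (chainW as bs)

chain : {r s : ℕ} → Tensor r → Tensor s → Tensor (r + s)
chain u v = concatMap (λ p → concatMap (λ q →
              map (λ t → (proj₁ p * proj₁ q * proj₁ t) , proj₂ t) (chainW (proj₂ p) (proj₂ q))) v) u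

Xt : Tensor 0
Xt = (+ 1 , X ∷ []) ∷ []

P : Tensor 1
P = (+ 1 , X ∷ Y ∷ []) ∷ (+ 1 , Y ∷ X ∷ []) ∷ []

-- P^m ∈ B^{⊗(m+1)}, the m-fold chaining product (P^1 = P, P^{m+1} = P · P^m).
-- P^0 is set to the unit Y of B (only m ≥ 1 is used).
Ppow : (m : ℕ) → Tensor m
Ppow zero = (+ 1 , Y ∷ []) ∷ []
Ppow (suc m) = chain P (Ppow m)

{-# OPTIONS --safe #-}
module Submission where

-- The last factor of a word of u · X is a product a X with a ∈ {X, Y, Z}, and
-- B X = span{X, Z} because X X = 2Z, Y X = X and Z X = 0.  Hence the terms of
-- u · X end in X or Z for every u ∈ B^{⊗r}.

open import Defs
open import Data.Nat using (ℕ; zero; suc; _≤_; _+_)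
open import Data.Integer using (ℤ; +_; _*_)
open import Data.Vec using (Vec; last; []; _∷_)
open import Data.Vec.Properties using (≡-dec)
open import Data.List using ([]; _∷_; map)
open import Data.List.Membership.Propositional using (_∈_)
open import Data.List.Relation.Unary.All as All using (All; []; _∷_)
open import Data.List.Relation.Unary.All.Properties using (map⁺; concat⁺)
open import Data.List.Relation.Unary.Any using (here; there)
open import Data.Product using (_×_; _,_; proj₁; proj₂)
open import Data.Sum using (_⊎_; inj₁; inj₂)
open import Function using (_∘_)
open import Relation.Nullary using (yes; no)
open import Relation.Binary.PropositionalEquality using (_≡_; _≢_; refl; sym)

XorZ : Gen → Set
XorZ g = g ≡ X ⊎ g ≡ Z

RightAbsorbs : (Gen → Set) → Gen → Set
RightAbsorbs Q b = ∀ a → All (Q ∘ proj₂) (genMul a b)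

XorZ-rightAbsorbs-X : RightAbsorbs XorZ X
XorZ-rightAbsorbs-X X = inj₂ refl ∷ []
XorZ-rightAbsorbs-X Y = inj₁ refl ∷ []
XorZ-rightAbsorbs-X Z = []

LastIn : (Gen → Set) → {n : ℕ} → ℤ × Vec Gen (suc n) → Set
LastIn Q (_ , w) = Q (last w)

chainW-lastIn : ∀ {Q b} → RightAbsorbs Q b → {r : ℕ} (v : Vec Gen (suc r)) →
                All (LastIn Q) (chainW v (b ∷ []))
chainW-lastIn Qb {zero} (a ∷ []) = map⁺ (Qb a)
chainW-lastIn Qb {suc r} (a ∷ v)  = map⁺ (chainW-lastIn Qb v)

chain-lastIn : ∀ {Q} {r : ℕ} (u : Tensor r) (v : Tensor 0) →
               All (λ q → RightAbsorbs Q (last (proj₂ q))) v →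
               All (LastIn Q) (chain u v)
chain-lastIn u v Qv =
  concat⁺ (map⁺ (All.universal (λ p → concat⁺ (map⁺ (All.map (scaled-chainW p) Qv))) u))
  where
  scaled-chainW : ∀ {Q} {r : ℕ} (p : ℤ × Vec Gen (suc r)) {q : ℤ × Vec Gen 1} →
                  RightAbsorbs Q (last (proj₂ q)) →
                  All (LastIn Q) (map (λ t → proj₁ p * proj₁ q * proj₁ t , proj₂ t)
                                      (chainW (proj₂ p) (proj₂ q)))
  scaled-chainW (_ , w) {_ , b ∷ []} Qb = map⁺ (chainW-lastIn Qb w)

coeff≢0⇒∈ : {n : ℕ} (u : Tensor n) (w : Vec Gen (suc n)) →
            coeff u w ≢ + 0 → w ∈ map proj₂ u
coeff≢0⇒∈ []      w c≢0 with () ← c≢0 refl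
coeff≢0⇒∈ (p ∷ u) w c≢0 with ≡-dec _≟G_ (proj₂ p) w
... | yes p≡w = here (sym p≡w)
... | no  _   = there (coeff≢0⇒∈ u w c≢0)

lemma4p4 : (m : ℕ) → 1 ≤ m → (w : Vec Gen (suc (m + 0))) →
    coeff (chain (chain Xt (Ppow m)) Xt) w ≢ + 0 →
    last w ≡ X ⊎ last w ≡ Z
lemma4p4 m _ w c≢0 = All.lookup (map⁺ terms-end-in-XorZ) (coeff≢0⇒∈ _ w c≢0)
  where
  terms-end-in-XorZ : All (LastIn XorZ) (chain (chain Xt (Ppow m)) Xt)
  terms-end-in-XorZ = chain-lastIn (chain Xt (Ppow m)) Xt (XorZ-rightAbsorbs-X ∷ [])
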